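{- Let $d_1,\ldots,d_r$ be positive integers and let $\Xi(d_1,d_2,\ldots,d_r)=P_{d_1}\,\square\, P_{d_2}\,\square\,\cdots\,\square\, P_{d_r}$ be the $r$-dimensional grid. If $d_1\geq \big((d_2-1)+(d_3-1)+\cdots+(d_r-1)\big)\,(d_2d_3\cdots d_r)$, then ${\rm ip}_{p}(\Xi(d_1,\ldots,d_r))={\rm ip}_{c}(\Xi(d_1,\ldots,d_r))=d_2d_3\cdots d_r$.
   Context: $P_d$ is the path on $d$ vertices and $\square$ the Cartesian product. A path is isometric if its length equals the distance between its endpoints; single vertices count as paths. ${\rm ip}_{c}(H)$ (resp. ${\rm ip}_{p}(H)$) is the minimum number of isometric paths of $H$ whose vertex sets cover (resp. partition) $V(H)$. -}

module Defs where

open import Data.Nat using (ℕ; zero; suc; _≤_; _+_; _*_; _∸_)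
open import Data.Fin using (Fin; toℕ; fromℕ; inject₁)
import Data.Fin as F
open import Data.List using (List; []; _∷_)
open import Data.Product using (Σ; ∃; _×_; _,_)
open import Data.Sum using (_⊎_)
open import Data.Unit using (⊤)
open import Relation.Binary.PropositionalEquality using (_≡_)
open import Function.Definitions using (Injective)

record Graph : Set₁ where
  field
    V   : Set
    Adj : V → V → Set

open Graph public

P : ℕ → Graph
P d = record { V = Fin d ; Adj = λ x y → (toℕ y ≡ suc (toℕ x)) ⊎ (toℕ x ≡ suc (toℕ y)) }

_□_ : Graph → Graph → Graph
G □ H = record
  { V   = V G × V H
  ; Adj = λ { (g , h) (g' , h') → (Adj G g g' × h ≡ h') ⊎ (g ≡ g' × Adj H h h') } }

infixr 5 _□_

K1 : Graph
K1 = record { V = ⊤ ; Adj = λ _ _ → Data.Empty.⊥ }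
  where import Data.Empty

-- Grid Ξ(d₁, d₂, …, d_r) = P_{d₁} □ (P_{d₂} □ ( … □ (P_{d_r} □ K1))).
Ξ : ℕ → List ℕ → Graph
Ξ d₁ ds = P d₁ □ rest ds
  where
  rest : List ℕ → Graph
  rest []       = K1
  rest (d ∷ ds) = P d □ rest ds

record Walk (G : Graph) (u v : V G) (ℓ : ℕ) : Set where
  field
    vert  : Fin (suc ℓ) → V G
    start : vert F.zero ≡ u
    end   : vert (fromℕ ℓ) ≡ v
    step  : (t : Fin ℓ) → Adj G (vert (inject₁ t)) (vert (F.suc t))

-- An isometric path: a path (walk with pairwise distinct vertices) whose
-- length equals the distance between its endpoints, i.e. no walk between
-- the endpoints is shorter.
record IsoPath (G : Graph) : Set where
  field
    len       : ℕ
    vert      : Fin (suc len) → V G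
    step      : (t : Fin len) → Adj G (vert (inject₁ t)) (vert (F.suc t))
    distinct  : Injective _≡_ _≡_ vert
    isometric : (m : ℕ) → Walk G (vert F.zero) (vert (fromℕ len)) m → len ≤ m

_∈P_ : {G : Graph} → V G → IsoPath G → Set
v ∈P p = ∃ λ t → IsoPath.vert p t ≡ v

IsoCover : (G : Graph) → ℕ → Set
IsoCover G k = Σ (Fin k → IsoPath G) λ ps → (v : V G) → ∃ λ i → v ∈P ps i

IsoPartition : (G : Graph) → ℕ → Set
IsoPartition G k = Σ (Fin k → IsoPath G) λ ps →
  ((v : V G) → ∃ λ i → v ∈P ps i) ×
  ((v : V G) (i j : Fin k) → v ∈P ps i → v ∈P ps j → i ≡ j)

ipc≡ : Graph → ℕ → Set
ipc≡ G k = IsoCover G k × ((k' : ℕ) → IsoCover G k' → k ≤ k')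

ipp≡ : Graph → ℕ → Set
ipp≡ G k = IsoPartition G k × ((k' : ℕ) → IsoPartition G k' → k ≤ k')

-- An isometric path of a graph of diameter D has at most D + 1 vertices, so covering the
-- d₁ · p vertices of Ξ, where p = d₂ ⋯ d_r, needs at least d₁ p / (d₁ + S) paths,
-- S = (d₂ − 1) + ⋯ + (d_r − 1); the hypothesis S p ≤ d₁ pushes this bound above p − 1.
-- Conversely the p "columns" P_{d₁} × {h} partition the grid, and each is isometric
-- because every step changes the first coordinate by at most one.
module Submission where

open import Defs
open import Data.Nat using (ℕ; zero; suc; _+_; _*_; _∸_; _≤_; _>_; z≤n; s≤s; _≤?_)
open import Data.Nat.Properties
open import Data.Nat.ListAction using (sum; product)
open import Data.List using (List; []; _∷_; map)
open import Data.List.Relation.Unary.All using (All)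
open import Data.Product using (Σ; ∃; _×_; _,_; proj₁; proj₂)
open import Data.Product.Properties using (,-injective)
open import Data.Product.Function.NonDependent.Propositional using (_×-↔_)
open import Data.Sum using (inj₁; inj₂)
import Data.Sum as Sum
open import Data.Unit using (tt)
open import Data.Fin using (Fin; toℕ; fromℕ; inject₁; inject≤)
import Data.Fin as F
open import Data.Fin.Properties
  using (toℕ-fromℕ; toℕ-inject₁; inject≤-injective; injective⇒≤; 1↔⊤; *↔×)
open import Function.Base using (_∘_)
open import Function.Bundles using (_↔_; _↣_; Inverse; Injection; mk↣)
open import Function.Properties.Inverse using (↔-refl; ↔-sym; ↔-trans; Inverse⇒Injection)
open import Function.Properties.Injection using (↣-trans)
open import Relation.Binary.PropositionalEquality
open import Relation.Nullary using (yes; no; contradiction)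

data Steps (G : Graph) : V G → V G → ℕ → Set where
  []  : ∀ {u} → Steps G u u 0
  _∷_ : ∀ {u w v n} → Adj G u w → Steps G w v n → Steps G u v (suc n)

Steps⇒Walk : ∀ {G u v n} → Steps G u v n → Walk G u v n
Steps⇒Walk {u = u} [] = record { vert = λ _ → u ; start = refl ; end = refl ; step = λ () }
Steps⇒Walk {G} {u} {n = suc n} (a ∷ s) = record
  { vert = vert ; start = refl ; end = Walk.end w ; step = step }
  where
  w = Steps⇒Walk s
  vert : Fin (suc (suc n)) → V G
  vert F.zero    = u
  vert (F.suc t) = Walk.vert w t
  step : (t : Fin (suc n)) → Adj G (vert (inject₁ t)) (vert (F.suc t))
  step F.zero    = subst (Adj G u) (sym (Walk.start w)) a
  step (F.suc t) = Walk.step w t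

_++_ : ∀ {G u w v m n} → Steps G u w m → Steps G w v n → Steps G u v (m + n)
[]      ++ t = t
(a ∷ s) ++ t = a ∷ (s ++ t)

liftˡ : ∀ {G H g g' n} (h : V H) → Steps G g g' n → Steps (G □ H) (g , h) (g' , h) n
liftˡ h []      = []
liftˡ h (a ∷ s) = inj₁ (a , refl) ∷ liftˡ h s

liftʳ : ∀ {G H h h' n} (g : V G) → Steps H h h' n → Steps (G □ H) (g , h) (g , h') n
liftʳ g []      = []
liftʳ g (a ∷ s) = inj₂ (refl , a) ∷ liftʳ g s

liftSuc : ∀ {d x y n} → Steps (P d) x y n → Steps (P (suc d)) (F.suc x) (F.suc y) n
liftSuc []      = []
liftSuc (a ∷ s) = Sum.map (cong suc) (cong suc) a ∷ liftSuc s

HasDiameter : Graph → ℕ → Set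
HasDiameter G D = ∀ u v → Σ ℕ λ n → n ≤ D × Steps G u v n

□-diameter : ∀ {G H a b} → HasDiameter G a → HasDiameter H b → HasDiameter (G □ H) (a + b)
□-diameter dG dH (g , h) (g' , h') with dG g g' | dH h h'
... | m , m≤a , s | n , n≤b , t = m + n , +-mono-≤ m≤a n≤b , liftˡ h s ++ liftʳ g' t

K1-diameter : HasDiameter K1 0
K1-diameter tt tt = 0 , z≤n , []

P-diameter : ∀ d → HasDiameter (P d) (d ∸ 1)
P-diameter _ F.zero F.zero = 0 , z≤n , []
P-diameter (suc d) (F.suc x) (F.suc y) with P-diameter d x y
... | n , n≤ , s = n , ≤-trans n≤ (m∸n≤m d 1) , liftSuc s
P-diameter (suc (suc d)) F.zero (F.suc y) with P-diameter (suc d) F.zero y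
... | n , n≤ , s = suc n , s≤s n≤ , inj₁ refl ∷ liftSuc s
P-diameter (suc (suc d)) (F.suc x) F.zero with P-diameter (suc d) x F.zero
... | n , n≤ , s = n + 1 , subst (_≤ suc d) (+-comm 1 n) (s≤s n≤) ,
                   liftSuc s ++ (inj₂ refl ∷ [])

IsoPath-len≤diameter : ∀ {G D} → HasDiameter G D → (p : IsoPath G) → IsoPath.len p ≤ D
IsoPath-len≤diameter dG p with dG (IsoPath.vert p F.zero) (IsoPath.vert p (fromℕ (IsoPath.len p)))
... | n , n≤D , s = ≤-trans (IsoPath.isometric p n (Steps⇒Walk s)) n≤D

cover↣ : ∀ {G D k} → HasDiameter G D → IsoCover G k → V G ↣ (Fin k × Fin (suc D))
cover↣ {G} {D} {k} dG (ps , covers) = mk↣ {to = position} position-injective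
  where
  len<1+D : ∀ i → suc (IsoPath.len (ps i)) ≤ suc D
  len<1+D i = s≤s (IsoPath-len≤diameter dG (ps i))
  position : V G → Fin k × Fin (suc D)
  position v with covers v
  ... | i , t , _ = i , inject≤ t (len<1+D i)
  position-injective : ∀ {v v'} → position v ≡ position v' → v ≡ v'
  position-injective {v} {v'} eq with covers v | covers v' | ,-injective eq
  ... | i , t , refl | .i , t' , refl | refl , t≡t' =
    cong (IsoPath.vert (ps i)) (inject≤-injective (len<1+D i) (len<1+D i) t t' t≡t')

IsoCover-size : ∀ {G D N k} → HasDiameter G D → V G ↔ Fin N → IsoCover G k → N ≤ k * suc D
IsoCover-size dG size cover = injective⇒≤ (Injection.injective counting)
  where
  counting = ↣-trans (Inverse⇒Injection (↔-sym size))
               (↣-trans (cover↣ dG cover) (Inverse⇒Injection (↔-sym *↔×)))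

unitSteps-bound : ∀ n (f : Fin (suc n) → ℕ) → (∀ t → f (F.suc t) ≤ suc (f (inject₁ t))) →
                  f (fromℕ n) ≤ n + f F.zero
unitSteps-bound zero    f rises = ≤-refl
unitSteps-bound (suc n) f rises =
  ≤-trans (rises (fromℕ n)) (s≤s (unitSteps-bound n (λ t → f (inject₁ t)) (λ t → rises (inject₁ t))))

P□-adj-rise : ∀ {d H} {a b : V (P d □ H)} → Adj (P d □ H) a b → toℕ (proj₁ b) ≤ suc (toℕ (proj₁ a))
P□-adj-rise (inj₁ (inj₁ up , _))   = ≤-reflexive up
P□-adj-rise (inj₁ (inj₂ down , _)) = ≤-trans (n≤1+n _) (≤-trans (≤-reflexive (sym down)) (n≤1+n _))
P□-adj-rise (inj₂ (refl , _))      = n≤1+n _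

column : ∀ {H} m → V H → IsoPath (P (suc m) □ H)
column {H} m h = record
  { len       = m
  ; vert      = λ t → t , h
  ; step      = λ t → inj₁ (inj₁ (cong suc (sym (toℕ-inject₁ t))) , refl)
  ; distinct  = cong proj₁
  ; isometric = isometric }
  where
  isometric : (n : ℕ) → Walk (P (suc m) □ H) (F.zero , h) (fromℕ m , h) n → m ≤ n
  isometric n w = begin
    m                   ≡⟨ sym (trans (cong (toℕ ∘ proj₁) (Walk.end w)) (toℕ-fromℕ m)) ⟩
    height (fromℕ n)    ≤⟨ unitSteps-bound n height (λ t → P□-adj-rise {H = H} (Walk.step w t)) ⟩
    n + height F.zero   ≡⟨ cong (λ v → n + toℕ (proj₁ v)) (Walk.start w) ⟩
    n + 0               ≡⟨ +-identityʳ n ⟩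
    n                   ∎
    where
    open ≤-Reasoning
    height : Fin (suc n) → ℕ
    height t = toℕ (proj₁ (Walk.vert w t))

∈column⇒≡ : ∀ {H m h} {v : V (P (suc m) □ H)} → v ∈P column {H} m h → proj₂ v ≡ h
∈column⇒≡ (_ , refl) = refl

columns : ∀ {H m p} → V H ↔ Fin p → IsoPartition (P (suc m) □ H) p
columns {H} {m} {p} size = (λ i → column {H} m (from i)) , covers , disjoint
  where
  open Inverse size
  covers : (v : V (P (suc m) □ H)) → ∃ λ i → v ∈P column {H} m (from i)
  covers (x , h) = to h , x , cong (x ,_) (strictlyInverseʳ h)
  disjoint : (v : V (P (suc m) □ H)) (i j : Fin p) →
             v ∈P column {H} m (from i) → v ∈P column {H} m (from j) → i ≡ j
  disjoint v i j v∈i v∈j = Injection.injective (Inverse⇒Injection (↔-sym size))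
    (trans (sym (∈column⇒≡ {H} v∈i)) (∈column⇒≡ {H} v∈j))

P□-size : ∀ {d H p} → V H ↔ Fin p → V (P d □ H) ↔ Fin (d * p)
P□-size size = ↔-trans (↔-refl ×-↔ size) (↔-sym *↔×)

cover-count⇒p≤k : ∀ {d s p k} → d > 0 → s * p ≤ d → d * p ≤ k * (d + s) → p ≤ k
cover-count⇒p≤k {d} {s} {p} {k} d>0 sp≤d count with p ≤? k
... | yes p≤k = p≤k
... | no p≰k = contradiction (subst (d ≤_) (trans (cong (k *_) s≡0) (*-zeroʳ k)) d≤ks) (<⇒≱ d>0)
  where
  open ≤-Reasoning
  k<p : suc k ≤ p
  k<p = ≰⇒> p≰k
  d≤ks : d ≤ k * s
  d≤ks = +-cancelˡ-≤ (d * k) d (k * s) (begin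
    d * k + d      ≡⟨ +-comm (d * k) d ⟩
    d + d * k      ≡⟨ *-suc d k ⟨
    d * suc k      ≤⟨ *-monoʳ-≤ d k<p ⟩
    d * p          ≤⟨ count ⟩
    k * (d + s)    ≡⟨ *-distribˡ-+ k d s ⟩
    k * d + k * s  ≡⟨ cong (_+ k * s) (*-comm k d) ⟩
    d * k + k * s  ∎)
  s≡0 : s ≡ 0
  s≡0 = n≤0⇒n≡0 (+-cancelˡ-≤ (s * k) s 0 (begin
    s * k + s      ≡⟨ +-comm (s * k) s ⟩
    s + s * k      ≡⟨ *-suc s k ⟨
    s * suc k      ≤⟨ *-monoʳ-≤ s k<p ⟩
    s * p          ≤⟨ sp≤d ⟩
    d              ≤⟨ d≤ks ⟩
    k * s          ≡⟨ *-comm k s ⟩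
    s * k          ≡⟨ +-identityʳ (s * k) ⟨
    s * k + 0      ∎))

IsoPartition⇒IsoCover : ∀ {G k} → IsoPartition G k → IsoCover G k
IsoPartition⇒IsoCover (ps , covers , _) = ps , covers

P□-ip : ∀ {H D p} m → HasDiameter H D → V H ↔ Fin p → D * p ≤ suc m →
        ipp≡ (P (suc m) □ H) p × ipc≡ (P (suc m) □ H) p
P□-ip {H} {D} {p} m dH size Dp≤ =
  (partition , λ k → atLeast k ∘ IsoPartition⇒IsoCover) ,
  (IsoPartition⇒IsoCover partition , atLeast)
  where
  partition : IsoPartition (P (suc m) □ H) p
  partition = columns size
  atLeast : (k : ℕ) → IsoCover (P (suc m) □ H) k → p ≤ k
  atLeast k cover = cover-count⇒p≤k (s≤s z≤n) Dp≤
    (IsoCover-size (□-diameter (P-diameter (suc m)) dH) (P□-size {suc m} {H} size) cover)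

Grid : List ℕ → Graph
Grid []       = K1
Grid (d ∷ ds) = Ξ d ds

Ξ≡P□Grid : ∀ d ds → Ξ d ds ≡ P d □ Grid ds
Ξ≡P□Grid d []      = refl
Ξ≡P□Grid d (_ ∷ _) = refl

Grid-diameter : ∀ ds → HasDiameter (Grid ds) (sum (map (λ d → d ∸ 1) ds))
Grid-diameter []           = K1-diameter
Grid-diameter (d ∷ [])     = □-diameter (P-diameter d) K1-diameter
Grid-diameter (d ∷ e ∷ ds) = □-diameter (P-diameter d) (Grid-diameter (e ∷ ds))

Grid-size : ∀ ds → V (Grid ds) ↔ Fin (product ds)
Grid-size []           = ↔-sym 1↔⊤
Grid-size (d ∷ [])     = P□-size {d} {K1} (Grid-size [])
Grid-size (d ∷ e ∷ ds) = P□-size {d} {Grid (e ∷ ds)} (Grid-size (e ∷ ds))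

theorem6 : (d₁ : ℕ) (ds : List ℕ) → d₁ > 0 → All (λ d → d > 0) ds →
    sum (map (λ d → d ∸ 1) ds) * product ds ≤ d₁ →
    ipp≡ (Ξ d₁ ds) (product ds) × ipc≡ (Ξ d₁ ds) (product ds)
theorem6 (suc m) ds _ _ Sp≤d₁ =
  subst (λ G → ipp≡ G (product ds) × ipc≡ G (product ds)) (sym (Ξ≡P□Grid (suc m) ds))
    (P□-ip m (Grid-diameter ds) (Grid-size ds) Sp≤d₁)
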